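{- Let $\Sigma=(\Gamma,\sigma)$ be a finite signed graph without loops, of order at least $4$, which is either $3$-connected, or edge $2$-connected with no vertices of degree $2$. Then $\Sigma$ is line consistent if and only if all edges of $\Sigma$ are positive.
   Context: A signed graph $\Sigma=(\Gamma,\sigma)$ is a graph $\Gamma$ (multiple edges allowed, no loops) with an edge signature $\sigma:E(\Gamma)\to\{+,-\}$. A circle is a cycle (in a multigraph two parallel edges form a circle of length 2). The line graph $L(\Gamma)$ has the edges of $\Gamma$ as vertices, two such vertices being joined by one edge for each common endpoint (so parallel edges of $\Gamma$ give a double edge in $L(\Gamma)$). The line graph of $\Sigma$ is the vertex-signed graph $(L(\Gamma),\sigma)$, where each vertex $e$ of $L(\Gamma)$ gets sign $\sigma(e)$. A vertex-signed graph is consistent if every circle has positive product of its vertex signs. $\Sigma$ is line consistent if $(L(\Gamma),\sigma)$ is consistent. The order is the number of vertices. -}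

module Defs where

open import Data.Nat as ℕ using (ℕ; zero; suc; _<_; _≤_)
open import Data.Fin as Fin using (Fin; zero; suc; toℕ; fromℕ<; _≟_)
open import Data.Fin.Subset using (Subset; _∉_; ∣_∣)
open import Data.List using (List; foldr; map; allFin)
open import Data.Nat.ListAction using (sum)
open import Data.Unit using (⊤)
open import Data.Sign using (Sign; +; -)
import Data.Sign as Sign
open import Data.Product using (_×_; Σ)
open import Data.Sum using (_⊎_)
open import Data.Bool using (if_then_else_)
open import Relation.Nullary using (¬_; yes; no; Dec)
open import Relation.Nullary.Decidable using (⌊_⌋; _⊎-dec_)
open import Relation.Binary.PropositionalEquality using (_≡_; _≢_)
open import Function using (_∘_)
open import Function.Definitions using (Injective)

record Graph (n m : ℕ) : Set where
  field
    end₁ end₂ : Fin m → Fin n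
    loopless : ∀ e → end₁ e ≢ end₂ e
open Graph public

IsEnd : ∀ {n m} → Graph n m → Fin n → Fin m → Set
IsEnd Γ x e = (end₁ Γ e ≡ x) ⊎ (end₂ Γ e ≡ x)

isEnd? : ∀ {n m} (Γ : Graph n m) x e → Dec (IsEnd Γ x e)
isEnd? Γ x e = (end₁ Γ e ≟ x) ⊎-dec (end₂ Γ e ≟ x)

Joins : ∀ {n m} → Graph n m → Fin m → Fin n → Fin n → Set
Joins Γ e u w = (end₁ Γ e ≡ u × end₂ Γ e ≡ w) ⊎ (end₁ Γ e ≡ w × end₂ Γ e ≡ u)

-- degree = number of incident edges (no loops, so each counts once)
degree : ∀ {n m} → Graph n m → Fin n → ℕ
degree {m = m} Γ v = sum (map (λ e → if ⌊ isEnd? Γ v e ⌋ then 1 else 0) (allFin m))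

-- walks using only allowed vertices (after the first) and allowed edges
data Walk {n m} (Γ : Graph n m) (okV : Fin n → Set) (okE : Fin m → Set)
       : Fin n → Fin n → Set where
  here : ∀ {u} → Walk Γ okV okE u u
  step : ∀ {u w v} (e : Fin m) → okE e → okV w → Joins Γ e u w →
         Walk Γ okV okE w v → Walk Γ okV okE u v

ConnectedMinusVertices : ∀ {n m} → Graph n m → Subset n → Set
ConnectedMinusVertices {n} {m} Γ S =
  ∀ (u v : Fin n) → u ∉ S → v ∉ S → Walk Γ (_∉ S) (λ _ → ⊤) u v

ConnectedMinusEdges : ∀ {n m} → Graph n m → Subset m → Set
ConnectedMinusEdges {n} {m} Γ F =
  ∀ (u v : Fin n) → Walk Γ (λ _ → ⊤) (_∉ F) u v

KConnected : ∀ {n m} → ℕ → Graph n m → Set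
KConnected {n} {m} k Γ = k < n × (∀ (S : Subset n) → ∣ S ∣ < k → ConnectedMinusVertices Γ S)

EdgeKConnected : ∀ {n m} → ℕ → Graph n m → Set
EdgeKConnected {n} {m} k Γ = ∀ (F : Subset m) → ∣ F ∣ < k → ConnectedMinusEdges Γ F

next : ∀ {k} → Fin (suc k) → Fin (suc k)
next {k} i with suc (toℕ i) ℕ.<? suc k
... | yes p = fromℕ< p
... | no _ = zero

-- A circle in the line graph L(Γ): vertices edge 0, …, edge (l-1) (distinct
-- edges of Γ, l = k+2 ≥ 2), consecutive ones (cyclically) joined by the
-- L(Γ)-edge corresponding to the common endpoint via i; the l L(Γ)-edges
-- used (unordered pair {edge i, edge (next i)} together with via i) are
-- pairwise distinct.
record LineCircle {n m} (Γ : Graph n m) : Set where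
  field
    k : ℕ
    edge : Fin (suc (suc k)) → Fin m
    edge-inj : Injective _≡_ _≡_ edge
    via : Fin (suc (suc k)) → Fin n
    via-common : ∀ i → IsEnd Γ (via i) (edge i) × IsEnd Γ (via i) (edge (next i))
    ledges-distinct : ∀ i j → i ≢ j →
      ¬ (via i ≡ via j ×
         ((edge i ≡ edge j × edge (next i) ≡ edge (next j)) ⊎
          (edge i ≡ edge (next j) × edge (next i) ≡ edge j)))
open LineCircle public

-- product of the vertex signs along a circle of L(Γ)
circleSign : ∀ {n m} {Γ : Graph n m} → (Fin m → Sign) → LineCircle Γ → Sign
circleSign σ C = foldr Sign._*_ + (map (σ ∘ edge C) (allFin (suc (suc (k C)))))

LineConsistent : ∀ {n m} → Graph n m → (Fin m → Sign) → Set
LineConsistent Γ σ = ∀ (C : LineCircle Γ) → circleSign σ C ≡ +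

-- If every edge is positive, every circle of L(Γ) is positive. Conversely, the
-- edges of a circle of Γ through a vertex v, in cyclic order, form a circle of
-- L(Γ); an edge e at v off that circle can be spliced in next to v, and
-- comparing the signs of the two circles of L(Γ) gives σ e = +. In a 3-connected
-- graph every edge vu misses such a circle: join two further neighbours of v by a
-- path in Γ − v. In an edge 2-connected graph every edge lies on a
-- circle, and a third edge at v (there is no vertex of degree 2) either shows
-- directly that e is positive, or shows that two other edges at v are positive,
-- and then the triangle they form with e in L(Γ) forces σ e = +.
module Submission where

open import Defs
open import Data.Nat as ℕ using (ℕ; zero; suc; _∸_; _≤_; _<_; z≤n; s≤s)
import Data.Nat.Properties as ℕₚ
open import Data.Nat.ListAction using (sum)
open import Data.Fin using (Fin; zero; suc; toℕ; fromℕ; inject₁; _≟_)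
import Data.Fin.Properties as Finₚ
open import Data.Fin.Relation.Unary.Top using (view; ‵fromℕ; ‵inject₁)
open import Data.Fin.Subset using (Subset; _∉_; ∣_∣; ⁅_⁆; _∪_; ∁; inside; outside)
open import Data.Fin.Subset.Properties
  using (x∈⁅x⁆; ∣⁅x⁆∣≡1; x≢y⇒x∉⁅y⁆; x∉⁅y⁆⇒x≢y; x∈p∪q⁺; x∈p∪q⁻; x∈∁p⇒x∉p; nonempty?;
         Empty-unique; ∣∁p∣≡n∸∣p∣; ∣⊥∣≡0)
open import Data.Vec using (_∷_; [])
open import Data.List using (List; []; _∷_; foldr; map; tabulate; allFin)
open import Data.List.Properties using (map-tabulate)
open import Data.Sign using (Sign; +; _*_)
open import Data.Sign.Properties using (*-identityʳ)
open import Data.Bool using (if_then_else_)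
open import Data.Product using (_×_; _,_; proj₁; proj₂; Σ; ∃; ∃₂)
open import Data.Sum using (_⊎_; inj₁; inj₂; [_,_]′)
open import Data.Unit using (⊤; tt)
open import Data.Empty using (⊥; ⊥-elim)
open import Function using (_∘_; id)
open import Function.Bundles using (_⇔_; mk⇔)
open import Function.Definitions using (Injective)
open import Relation.Nullary using (¬_; Dec; yes; no; ¬?; contradiction)
open import Relation.Nullary.Decidable
  using (⌊_⌋; _×-dec_; _⊎-dec_; isYes≗does; dec-true; dec-false)
open import Relation.Binary.PropositionalEquality

next-inject₁ : ∀ {k} (i : Fin (suc k)) → next (inject₁ i) ≡ suc i
next-inject₁ {k} i with suc (toℕ (inject₁ i)) ℕ.<? suc (suc k)
... | yes p = Finₚ.toℕ-injective (trans (Finₚ.toℕ-fromℕ< p) (cong suc (Finₚ.toℕ-inject₁ i)))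
... | no ¬p = contradiction (s≤s (subst (_< suc k) (sym (Finₚ.toℕ-inject₁ i)) (Finₚ.toℕ<n i))) ¬p

next-fromℕ : ∀ k → next (fromℕ k) ≡ zero
next-fromℕ k with suc (toℕ (fromℕ k)) ℕ.<? suc k
... | yes p = ⊥-elim (ℕₚ.n≮n (suc k) (subst (λ x → suc x < suc k) (Finₚ.toℕ-fromℕ k) p))
... | no _ = refl

next∘next≢id : ∀ {k} (i : Fin (suc (suc (suc k)))) → next (next i) ≢ i
next∘next≢id {k} i with view i
... | ‵fromℕ rewrite next-fromℕ (suc (suc k)) = λ ()
... | ‵inject₁ j rewrite next-inject₁ j with view j
...   | ‵fromℕ rewrite next-fromℕ (suc (suc k)) = λ ()
...   | ‵inject₁ j′ rewrite next-inject₁ (suc j′) = λ eq →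
  ℕₚ.m≢1+n+m (toℕ j′) {1}
    (sym (trans (cong toℕ eq) (trans (Finₚ.toℕ-inject₁ (inject₁ j′)) (Finₚ.toℕ-inject₁ j′))))

sum-tabulate-≡0 : ∀ {k} (c : Fin k → ℕ) → (∀ x → c x ≡ 0) → sum (tabulate c) ≡ 0
sum-tabulate-≡0 {zero} c c≡0 = refl
sum-tabulate-≡0 {suc k} c c≡0 rewrite c≡0 zero = sum-tabulate-≡0 (c ∘ suc) (c≡0 ∘ suc)

sum-tabulate-≡1 : ∀ {k} (c : Fin k → ℕ) {e} → c e ≡ 1 → (∀ x → x ≢ e → c x ≡ 0) →
  sum (tabulate c) ≡ 1
sum-tabulate-≡1 c {zero} ce≡1 rest≡0 rewrite ce≡1 =
  cong suc (sum-tabulate-≡0 (c ∘ suc) (λ x → rest≡0 (suc x) (λ ())))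
sum-tabulate-≡1 c {suc e} ce≡1 rest≡0 rewrite rest≡0 zero (λ ()) =
  sum-tabulate-≡1 (c ∘ suc) ce≡1 (λ x x≢e → rest≡0 (suc x) (x≢e ∘ Finₚ.suc-injective))

sum-tabulate-≡2 : ∀ {k} (c : Fin k → ℕ) {e f} → e ≢ f → c e ≡ 1 → c f ≡ 1 →
  (∀ x → x ≢ e → x ≢ f → c x ≡ 0) → sum (tabulate c) ≡ 2
sum-tabulate-≡2 c {zero} {zero} e≢f _ _ _ = contradiction refl e≢f
sum-tabulate-≡2 c {zero} {suc f} _ ce≡1 cf≡1 rest≡0 rewrite ce≡1 =
  cong suc (sum-tabulate-≡1 (c ∘ suc) cf≡1
    (λ x x≢f → rest≡0 (suc x) (λ ()) (x≢f ∘ Finₚ.suc-injective)))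
sum-tabulate-≡2 c {suc e} {zero} _ ce≡1 cf≡1 rest≡0 rewrite cf≡1 =
  cong suc (sum-tabulate-≡1 (c ∘ suc) ce≡1
    (λ x x≢e → rest≡0 (suc x) (x≢e ∘ Finₚ.suc-injective) (λ ())))
sum-tabulate-≡2 c {suc e} {suc f} e≢f ce≡1 cf≡1 rest≡0 rewrite rest≡0 zero (λ ()) (λ ()) =
  sum-tabulate-≡2 (c ∘ suc) (e≢f ∘ cong suc) ce≡1 cf≡1
    (λ x x≢e x≢f → rest≡0 (suc x) (x≢e ∘ Finₚ.suc-injective) (x≢f ∘ Finₚ.suc-injective))

∣p∪q∣≤∣p∣+∣q∣ : ∀ {k} (p q : Subset k) → ∣ p ∪ q ∣ ≤ ∣ p ∣ ℕ.+ ∣ q ∣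
∣p∪q∣≤∣p∣+∣q∣ [] [] = z≤n
∣p∪q∣≤∣p∣+∣q∣ (outside ∷ p) (outside ∷ q) = ∣p∪q∣≤∣p∣+∣q∣ p q
∣p∪q∣≤∣p∣+∣q∣ (inside ∷ p) (outside ∷ q) = s≤s (∣p∪q∣≤∣p∣+∣q∣ p q)
∣p∪q∣≤∣p∣+∣q∣ (outside ∷ p) (inside ∷ q) rewrite ℕₚ.+-suc ∣ p ∣ ∣ q ∣ = s≤s (∣p∪q∣≤∣p∣+∣q∣ p q)
∣p∪q∣≤∣p∣+∣q∣ (inside ∷ p) (inside ∷ q) rewrite ℕₚ.+-suc ∣ p ∣ ∣ q ∣ =
  s≤s (ℕₚ.m≤n⇒m≤1+n (∣p∪q∣≤∣p∣+∣q∣ p q))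

∣p∪⁅x⁆∣≤1+∣p∣ : ∀ {k} (p : Subset k) x → ∣ p ∪ ⁅ x ⁆ ∣ ≤ suc ∣ p ∣
∣p∪⁅x⁆∣≤1+∣p∣ p x =
  subst (∣ p ∪ ⁅ x ⁆ ∣ ≤_) (trans (cong (∣ p ∣ ℕ.+_) (∣⁅x⁆∣≡1 x)) (ℕₚ.+-comm ∣ p ∣ 1))
    (∣p∪q∣≤∣p∣+∣q∣ p ⁅ x ⁆)

∣⁅x⁆∣<2 : ∀ {k} (x : Fin k) → ∣ ⁅ x ⁆ ∣ < 2
∣⁅x⁆∣<2 x rewrite ∣⁅x⁆∣≡1 x = s≤s (s≤s z≤n)

∣⁅x⁆∪⁅y⁆∣<3 : ∀ {k} (x y : Fin k) → ∣ ⁅ x ⁆ ∪ ⁅ y ⁆ ∣ < 3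
∣⁅x⁆∪⁅y⁆∣<3 x y = s≤s (ℕₚ.≤-trans (∣p∪⁅x⁆∣≤1+∣p∣ ⁅ x ⁆ y) (∣⁅x⁆∣<2 x))

∃∉ : ∀ {k} (p : Subset k) → ∣ p ∣ < k → ∃ λ x → x ∉ p
∃∉ {k} p ∣p∣<k with nonempty? (∁ p)
... | yes (x , x∈∁p) = x , x∈∁p⇒x∉p x∈∁p
... | no ∁p-empty = ⊥-elim (ℕₚ.n≮n 0 (subst (0 <_) k∸∣p∣≡0 (ℕₚ.m<n⇒0<n∸m ∣p∣<k)))
  where
  k∸∣p∣≡0 : k ∸ ∣ p ∣ ≡ 0
  k∸∣p∣≡0 = trans (sym (∣∁p∣≡n∸∣p∣ p)) (trans (cong ∣_∣ (Empty-unique ∁p-empty)) (∣⊥∣≡0 k))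

product-map-positive : ∀ {A : Set} (s : A → Sign) (xs : List A) → (∀ x → s x ≡ +) →
  foldr _*_ + (map s xs) ≡ +
product-map-positive s [] _ = refl
product-map-positive s (x ∷ xs) s≡+ rewrite s≡+ x = product-map-positive s xs s≡+

module _ {n m : ℕ} (Γ : Graph n m) where

  Walk⊤ : Fin n → Fin n → Set
  Walk⊤ = Walk Γ (λ _ → ⊤) (λ _ → ⊤)

  edge-joins : ∀ e → Joins Γ e (end₁ Γ e) (end₂ Γ e)
  edge-joins e = inj₁ (refl , refl)

  Joins-sym : ∀ {e u w} → Joins Γ e u w → Joins Γ e w u
  Joins-sym (inj₁ ends) = inj₂ ends
  Joins-sym (inj₂ ends) = inj₁ ends

  Joins⇒≢ : ∀ {e u w} → Joins Γ e u w → u ≢ w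
  Joins⇒≢ (inj₁ (p , q)) u≡w = loopless Γ _ (trans p (trans u≡w (sym q)))
  Joins⇒≢ (inj₂ (p , q)) u≡w = loopless Γ _ (trans p (trans (sym u≡w) (sym q)))

  Joins-unique : ∀ {e v a b} → Joins Γ e v a → Joins Γ e v b → a ≡ b
  Joins-unique (inj₁ (_ , q)) (inj₁ (_ , s)) = trans (sym q) s
  Joins-unique (inj₁ (p , _)) (inj₂ (_ , s)) = ⊥-elim (loopless Γ _ (trans p (sym s)))
  Joins-unique (inj₂ (_ , q)) (inj₁ (r , _)) = ⊥-elim (loopless Γ _ (trans r (sym q)))
  Joins-unique (inj₂ (p , _)) (inj₂ (r , _)) = trans (sym p) r

  Joins⇒IsEnd₁ : ∀ {e u w} → Joins Γ e u w → IsEnd Γ u e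
  Joins⇒IsEnd₁ (inj₁ (p , _)) = inj₁ p
  Joins⇒IsEnd₁ (inj₂ (_ , q)) = inj₂ q

  Joins⇒IsEnd₂ : ∀ {e u w} → Joins Γ e u w → IsEnd Γ w e
  Joins⇒IsEnd₂ = Joins⇒IsEnd₁ ∘ Joins-sym

  IsEnd⇒Joins : ∀ {e v} → IsEnd Γ v e → ∃ λ w → Joins Γ e v w
  IsEnd⇒Joins {e} (inj₁ p) = end₂ Γ e , inj₁ (p , refl)
  IsEnd⇒Joins {e} (inj₂ p) = end₁ Γ e , inj₂ (refl , p)

  IsEnd-Joins : ∀ {e u w x} → Joins Γ e u w → IsEnd Γ x e → x ≡ u ⊎ x ≡ w
  IsEnd-Joins (inj₁ (p , _)) (inj₁ r) = inj₁ (trans (sym r) p)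
  IsEnd-Joins (inj₁ (_ , q)) (inj₂ r) = inj₂ (trans (sym r) q)
  IsEnd-Joins (inj₂ (p , _)) (inj₁ r) = inj₂ (trans (sym r) p)
  IsEnd-Joins (inj₂ (_ , q)) (inj₂ r) = inj₁ (trans (sym r) q)

  module _ {P : Fin n → Set} {Q : Fin m → Set} where

    len : ∀ {a b} → Walk Γ P Q a b → ℕ
    len here = 0
    len (step _ _ _ _ W) = suc (len W)

    edgeAt : ∀ {a b} (W : Walk Γ P Q a b) → Fin (len W) → Fin m
    edgeAt (step e _ _ _ W) zero = e
    edgeAt (step e _ _ _ W) (suc i) = edgeAt W i

    vertexAt : ∀ {a b} (W : Walk Γ P Q a b) → Fin (suc (len W)) → Fin n
    vertexAt (here {u}) zero = u
    vertexAt (step {u} _ _ _ _ W) zero = u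
    vertexAt (step _ _ _ _ W) (suc i) = vertexAt W i

    vertexAt-zero : ∀ {a b} (W : Walk Γ P Q a b) → vertexAt W zero ≡ a
    vertexAt-zero here = refl
    vertexAt-zero (step _ _ _ _ _) = refl

    vertexAt-last : ∀ {a b} (W : Walk Γ P Q a b) → vertexAt W (fromℕ (len W)) ≡ b
    vertexAt-last here = refl
    vertexAt-last (step _ _ _ _ W) = vertexAt-last W

    edgeAt-joins : ∀ {a b} (W : Walk Γ P Q a b) (i : Fin (len W)) →
      Joins Γ (edgeAt W i) (vertexAt W (inject₁ i)) (vertexAt W (suc i))
    edgeAt-joins (step _ _ _ j W) zero rewrite vertexAt-zero W = j
    edgeAt-joins (step _ _ _ _ W) (suc i) = edgeAt-joins W i

    InV : ∀ {a b} → Fin n → Walk Γ P Q a b → Set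
    InV x (here {u}) = x ≡ u
    InV x (step {u} _ _ _ _ W) = x ≡ u ⊎ InV x W

    InE : ∀ {a b} → Fin m → Walk Γ P Q a b → Set
    InE x here = ⊥
    InE x (step e _ _ _ W) = x ≡ e ⊎ InE x W

    inV? : ∀ {a b} x (W : Walk Γ P Q a b) → Dec (InV x W)
    inV? x (here {u}) = x ≟ u
    inV? x (step {u} _ _ _ _ W) = (x ≟ u) ⊎-dec inV? x W

    start∈ : ∀ {a b} (W : Walk Γ P Q a b) → InV a W
    start∈ here = refl
    start∈ (step _ _ _ _ _) = inj₁ refl

    InV⇒start⊎P : ∀ {a b x} (W : Walk Γ P Q a b) → InV x W → x ≡ a ⊎ P x
    InV⇒start⊎P here x≡a = inj₁ x≡a
    InV⇒start⊎P (step _ _ _ _ W) (inj₁ x≡a) = inj₁ x≡a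
    InV⇒start⊎P (step _ _ Pw _ W) (inj₂ x∈W) with InV⇒start⊎P W x∈W
    ... | inj₁ refl = inj₂ Pw
    ... | inj₂ Px = inj₂ Px

    edgeAt∈ : ∀ {a b} (W : Walk Γ P Q a b) i → InE (edgeAt W i) W
    edgeAt∈ (step _ _ _ _ W) zero = inj₁ refl
    edgeAt∈ (step _ _ _ _ W) (suc i) = inj₂ (edgeAt∈ W i)

    InE⇒ends-InV : ∀ {a b x e} (W : Walk Γ P Q a b) → InE e W → IsEnd Γ x e → InV x W
    InE⇒ends-InV (step _ _ _ j W) (inj₁ refl) x-e with IsEnd-Joins j x-e
    ... | inj₁ x≡u = inj₁ x≡u
    ... | inj₂ refl = inj₂ (start∈ W)
    InE⇒ends-InV (step _ _ _ _ W) (inj₂ e∈W) x-e = inj₂ (InE⇒ends-InV W e∈W x-e)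

    ∉V⇒∉E : ∀ {a b x e} (W : Walk Γ P Q a b) → ¬ InV x W → IsEnd Γ x e → ¬ InE e W
    ∉V⇒∉E W x∉W x-e e∈W = x∉W (InE⇒ends-InV W e∈W x-e)

    Simple : ∀ {a b} → Walk Γ P Q a b → Set
    Simple here = ⊤
    Simple (step {u} _ _ _ _ W) = ¬ InV u W × Simple W

    Trail : ∀ {a b} → Walk Γ P Q a b → Set
    Trail here = ⊤
    Trail (step e _ _ _ W) = ¬ InE e W × Trail W

    Simple⇒Trail : ∀ {a b} (W : Walk Γ P Q a b) → Simple W → Trail W
    Simple⇒Trail here _ = tt
    Simple⇒Trail (step _ _ _ j W) (u∉W , simple) =
      ∉V⇒∉E W u∉W (Joins⇒IsEnd₁ j) , Simple⇒Trail W simple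

    Trail⇒edgeAt-injective : ∀ {a b} (W : Walk Γ P Q a b) → Trail W →
      Injective _≡_ _≡_ (edgeAt W)
    Trail⇒edgeAt-injective (step _ _ _ _ W) _ {zero} {zero} _ = refl
    Trail⇒edgeAt-injective (step _ _ _ _ W) (e∉W , _) {zero} {suc j} eq =
      contradiction (subst (λ x → InE x W) (sym eq) (edgeAt∈ W j)) e∉W
    Trail⇒edgeAt-injective (step _ _ _ _ W) (e∉W , _) {suc i} {zero} eq =
      contradiction (subst (λ x → InE x W) eq (edgeAt∈ W i)) e∉W
    Trail⇒edgeAt-injective (step _ _ _ _ W) (_ , trail) {suc i} {suc j} eq =
      cong suc (Trail⇒edgeAt-injective W trail eq)

    dropUntil : ∀ {a b x} (W : Walk Γ P Q a b) → InV x W → Walk Γ P Q x b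
    dropUntil here refl = here
    dropUntil W@(step _ _ _ _ _) (inj₁ refl) = W
    dropUntil (step _ _ _ _ W) (inj₂ x∈W) = dropUntil W x∈W

    dropUntil-simple : ∀ {a b x} (W : Walk Γ P Q a b) (x∈W : InV x W) → Simple W →
      Simple (dropUntil W x∈W)
    dropUntil-simple here refl _ = tt
    dropUntil-simple (step _ _ _ _ _) (inj₁ refl) simple = simple
    dropUntil-simple (step _ _ _ _ W) (inj₂ x∈W) (_ , simple) = dropUntil-simple W x∈W simple

    toSimple : ∀ {a b} → Walk Γ P Q a b → Σ (Walk Γ P Q a b) Simple
    toSimple here = here , tt
    toSimple (step {u} e Qe Pw j W) with toSimple W
    ... | W′ , simple with inV? u W′
    ... | yes u∈W′ = dropUntil W′ u∈W′ , dropUntil-simple W′ u∈W′ simple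
    ... | no u∉W′ = step e Qe Pw j W′ , u∉W′ , simple

    firstStep : ∀ {a b} → Walk Γ P Q a b → a ≢ b → ∃₂ λ e w → Q e × P w × Joins Γ e a w
    firstStep here a≢a = contradiction refl a≢a
    firstStep (step e Qe Pw j _) _ = e , _ , Qe , Pw , j

  unrestrict : ∀ {P Q a b} → Walk Γ P Q a b → Walk⊤ a b
  unrestrict here = here
  unrestrict (step e _ _ j W) = step e tt tt j (unrestrict W)

  InV-unrestrict : ∀ {P Q a b x} (W : Walk Γ P Q a b) → InV x (unrestrict W) → InV x W
  InV-unrestrict here x≡a = x≡a
  InV-unrestrict (step _ _ _ _ W) (inj₁ x≡a) = inj₁ x≡a
  InV-unrestrict (step _ _ _ _ W) (inj₂ x∈W) = inj₂ (InV-unrestrict W x∈W)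

  unrestrict-simple : ∀ {P Q a b} (W : Walk Γ P Q a b) → Simple W → Simple (unrestrict W)
  unrestrict-simple here _ = tt
  unrestrict-simple (step _ _ _ _ W) (u∉W , simple) =
    u∉W ∘ InV-unrestrict W , unrestrict-simple W simple

  snoc : ∀ {a b c} → Walk⊤ a b → (g : Fin m) → Joins Γ g b c → Walk⊤ a c
  snoc here g j = step g tt tt j here
  snoc (step e _ _ j′ W) g j = step e tt tt j′ (snoc W g j)

  InE-snoc : ∀ {a b c e} (W : Walk⊤ a b) g (j : Joins Γ g b c) →
    InE e (snoc W g j) → InE e W ⊎ e ≡ g
  InE-snoc here g j (inj₁ e≡g) = inj₂ e≡g
  InE-snoc (step _ _ _ _ W) g j (inj₁ e≡e′) = inj₁ (inj₁ e≡e′)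
  InE-snoc (step _ _ _ _ W) g j (inj₂ e∈W) with InE-snoc W g j e∈W
  ... | inj₁ e∈W′ = inj₁ (inj₂ e∈W′)
  ... | inj₂ e≡g = inj₂ e≡g

  snoc-trail : ∀ {a b c} (W : Walk⊤ a b) g (j : Joins Γ g b c) →
    Trail W → ¬ InE g W → Trail (snoc W g j)
  snoc-trail here g j _ _ = (λ ()) , tt
  snoc-trail (step e _ _ _ W) g j (e∉W , trail) g∉W =
    [ e∉W , (λ e≡g → g∉W (inj₁ (sym e≡g))) ]′ ∘ InE-snoc W g j ,
    snoc-trail W g j trail (g∉W ∘ inj₂)

  LineEdgesDistinct : ∀ {k} → (Fin (suc (suc k)) → Fin m) → (Fin (suc (suc k)) → Fin n) → Set
  LineEdgesDistinct edge via = ∀ i j → i ≢ j →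
    ¬ (via i ≡ via j ×
       ((edge i ≡ edge j × edge (next i) ≡ edge (next j)) ⊎
        (edge i ≡ edge (next j) × edge (next i) ≡ edge j)))

  -- Two steps of the circle can only use the same edge of L(Γ) if the circle
  -- has length 2 and both steps pass through the same vertex.
  lineEdgesDistinct : ∀ {k} {edge : Fin (suc (suc k)) → Fin m} {via} →
    Injective _≡_ _≡_ edge → (∀ i → next (next i) ≡ i → via i ≢ via (next i)) →
    LineEdgesDistinct edge via
  lineEdgesDistinct inj _ i j i≢j (_ , inj₁ (eᵢ≡eⱼ , _)) = i≢j (inj eᵢ≡eⱼ)
  lineEdgesDistinct {via = via} inj 2-cycle i j _ (vᵢ≡vⱼ , inj₂ (eᵢ≡eₙⱼ , eₙᵢ≡eⱼ)) =
    2-cycle i (trans (cong next (inj eₙᵢ≡eⱼ)) (sym (inj eᵢ≡eₙⱼ)))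
      (trans vᵢ≡vⱼ (cong via (sym (inj eₙᵢ≡eⱼ))))

  lineEdgesDistinct₃ : ∀ {k} {edge : Fin (suc (suc (suc k))) → Fin m} {via} →
    Injective _≡_ _≡_ edge → LineEdgesDistinct edge via
  lineEdgesDistinct₃ inj = lineEdgesDistinct inj (λ i nn≡id → contradiction nn≡id (next∘next≢id i))

  lastVia : LineCircle Γ → Fin n
  lastVia D = via D (fromℕ (suc (k D)))

  lineCircleOfClosedTrail : ∀ {P Q a} (C : Walk Γ P Q a a) → Trail C → 0 < len C →
    Σ (LineCircle Γ) λ D → (∀ i → InE (edge D i) C) × lastVia D ≡ a
  lineCircleOfClosedTrail here _ ()
  lineCircleOfClosedTrail (step _ _ _ j here) _ _ = contradiction refl (Joins⇒≢ j)
  lineCircleOfClosedTrail C@(step _ _ _ _ (step _ _ _ _ W)) trail _ =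
    D , edgeAt∈ C , vertexAt-last C
    where
    closes : ∀ i → vertexAt C (suc i) ≡ vertexAt C (inject₁ (next i))
    closes i with view i
    ... | ‵fromℕ rewrite next-fromℕ (suc (len W)) = vertexAt-last C
    ... | ‵inject₁ j rewrite next-inject₁ j = refl

    D : LineCircle Γ
    D = record
      { k = len W
      ; edge = edgeAt C
      ; edge-inj = Trail⇒edgeAt-injective C trail
      ; via = vertexAt C ∘ suc
      ; via-common = λ i →
          Joins⇒IsEnd₂ (edgeAt-joins C i) ,
          subst (λ x → IsEnd Γ x (edgeAt C (next i))) (sym (closes i))
            (Joins⇒IsEnd₁ (edgeAt-joins C (next i)))
      ; ledges-distinct = lineEdgesDistinct (Trail⇒edgeAt-injective C trail)
          (λ i _ → Joins⇒≢ (edgeAt-joins C (next i)) ∘ trans (sym (closes i)))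
      }

  consLineCircle : (D : LineCircle Γ) (e : Fin m) → (∀ i → e ≢ edge D i) →
    IsEnd Γ (lastVia D) e → LineCircle Γ
  consLineCircle D e e∉D e-at-last = record
    { k = suc (k D)
    ; edge = edge′
    ; edge-inj = edge′-inj
    ; via = via′
    ; via-common = common
    ; ledges-distinct = lineEdgesDistinct₃ edge′-inj
    }
    where
    last : Fin (suc (suc (k D)))
    last = fromℕ (suc (k D))

    edge′ : Fin (suc (suc (suc (k D)))) → Fin m
    edge′ zero = e
    edge′ (suc i) = edge D i

    via′ : Fin (suc (suc (suc (k D)))) → Fin n
    via′ zero = via D last
    via′ (suc i) = via D i

    edge′-inj : Injective _≡_ _≡_ edge′
    edge′-inj {zero} {zero} _ = refl
    edge′-inj {zero} {suc j} eq = contradiction eq (e∉D j)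
    edge′-inj {suc i} {zero} eq = contradiction (sym eq) (e∉D i)
    edge′-inj {suc i} {suc j} eq = cong suc (edge-inj D eq)

    common : ∀ i → IsEnd Γ (via′ i) (edge′ i) × IsEnd Γ (via′ i) (edge′ (next i))
    common zero =
      e-at-last ,
      subst (IsEnd Γ (via D last) ∘ edge D) (next-fromℕ (suc (k D))) (proj₂ (via-common D last))
    common (suc i) with view i
    ... | ‵fromℕ rewrite next-fromℕ (suc (suc (k D))) = proj₁ (via-common D last) , e-at-last
    ... | ‵inject₁ j rewrite next-inject₁ (suc j) | sym (next-inject₁ j) = via-common D (inject₁ j)

  circleSign-tabulate : ∀ (σ : Fin m → Sign) (D : LineCircle Γ) →
    circleSign σ D ≡ foldr _*_ + (tabulate (σ ∘ edge D))
  circleSign-tabulate σ D = cong (foldr _*_ +) (map-tabulate id (σ ∘ edge D))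

  circleSign-cons : ∀ (σ : Fin m → Sign) (D : LineCircle Γ) e e∉D e-at-last →
    circleSign σ (consLineCircle D e e∉D e-at-last) ≡ σ e * circleSign σ D
  circleSign-cons σ D e e∉D e-at-last =
    trans (circleSign-tabulate σ (consLineCircle D e e∉D e-at-last))
      (cong (σ e *_) (sym (circleSign-tabulate σ D)))

  record CircleThrough (v : Fin n) (f g : Fin m) : Set where
    field
      a b : Fin n
      f≢g : f ≢ g
      f-joins : Joins Γ f v a
      g-joins : Joins Γ g b v
      path : Walk⊤ a b
      path-simple : Simple path
      v∉path : ¬ InV v path

    closedWalk : Walk⊤ v v
    closedWalk = step f tt tt f-joins (snoc path g g-joins)

    closedWalk-trail : Trail closedWalk
    closedWalk-trail =
      [ ∉V⇒∉E path v∉path (Joins⇒IsEnd₁ f-joins) , f≢g ]′ ∘ InE-snoc path g g-joins ,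
      snoc-trail path g g-joins (Simple⇒Trail path path-simple)
        (∉V⇒∉E path v∉path (Joins⇒IsEnd₂ g-joins))

    off-closedWalk : ∀ {e} → IsEnd Γ v e → e ≢ f → e ≢ g → ¬ InE e closedWalk
    off-closedWalk v-e e≢f _ (inj₁ e≡f) = e≢f e≡f
    off-closedWalk v-e _ e≢g (inj₂ e∈C) =
      [ ∉V⇒∉E path v∉path v-e , e≢g ]′ (InE-snoc path g g-joins e∈C)

  open CircleThrough

  module _ {σ : Fin m → Sign} (consistent : LineConsistent Γ σ) where

    positive-off-circle : ∀ {v e f g} → CircleThrough v f g → IsEnd Γ v e → e ≢ f → e ≢ g →
      σ e ≡ +
    positive-off-circle {v} {e} C v-e e≢f e≢g
      with lineCircleOfClosedTrail (closedWalk C) (closedWalk-trail C) (s≤s z≤n)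
    ... | D , edges∈C , lastVia≡v = begin
      σ e                   ≡⟨ sym (*-identityʳ (σ e)) ⟩
      σ e * +               ≡⟨ cong (σ e *_) (sym (consistent D)) ⟩
      σ e * circleSign σ D  ≡⟨ sym (circleSign-cons σ D e e∉D e-at-last) ⟩
      circleSign σ D′       ≡⟨ consistent D′ ⟩
      + ∎
      where
      open ≡-Reasoning
      e∉D : ∀ i → e ≢ edge D i
      e∉D i e≡eᵢ = off-closedWalk C v-e e≢f e≢g
        (subst (λ x → InE x (closedWalk C)) (sym e≡eᵢ) (edges∈C i))
      e-at-last : IsEnd Γ (lastVia D) e
      e-at-last = subst (λ x → IsEnd Γ x e) (sym lastVia≡v) v-e
      D′ : LineCircle Γ
      D′ = consLineCircle D e e∉D e-at-last

    positive-triangle : ∀ {v e f g} → IsEnd Γ v e → IsEnd Γ v f → IsEnd Γ v g →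
      e ≢ f → e ≢ g → f ≢ g → σ f ≡ + → σ g ≡ + → σ e ≡ +
    positive-triangle {v} {e} {f} {g} v-e v-f v-g e≢f e≢g f≢g σf≡+ σg≡+ = begin
      σ e                      ≡⟨ sym (*-identityʳ (σ e)) ⟩
      σ e * (+ * (+ * +))      ≡⟨ cong₂ (λ s t → σ e * (s * (t * +))) (sym σf≡+) (sym σg≡+) ⟩
      σ e * (σ f * (σ g * +))  ≡⟨ sym (circleSign-tabulate σ triangle) ⟩
      circleSign σ triangle    ≡⟨ consistent triangle ⟩
      + ∎
      where
      open ≡-Reasoning
      edge₃ : Fin 3 → Fin m
      edge₃ zero = e
      edge₃ (suc zero) = f
      edge₃ (suc (suc zero)) = g

      edge₃-inj : Injective _≡_ _≡_ edge₃
      edge₃-inj {zero} {zero} _ = refl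
      edge₃-inj {zero} {suc zero} eq = contradiction eq e≢f
      edge₃-inj {zero} {suc (suc zero)} eq = contradiction eq e≢g
      edge₃-inj {suc zero} {zero} eq = contradiction (sym eq) e≢f
      edge₃-inj {suc zero} {suc zero} _ = refl
      edge₃-inj {suc zero} {suc (suc zero)} eq = contradiction eq f≢g
      edge₃-inj {suc (suc zero)} {zero} eq = contradiction (sym eq) e≢g
      edge₃-inj {suc (suc zero)} {suc zero} eq = contradiction (sym eq) f≢g
      edge₃-inj {suc (suc zero)} {suc (suc zero)} _ = refl

      at-v : ∀ i → IsEnd Γ v (edge₃ i)
      at-v zero = v-e
      at-v (suc zero) = v-f
      at-v (suc (suc zero)) = v-g

      triangle : LineCircle Γ
      triangle = record
        { k = 1
        ; edge = edge₃
        ; edge-inj = edge₃-inj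
        ; via = λ _ → v
        ; via-common = λ i → at-v i , at-v (next i)
        ; ledges-distinct = lineEdgesDistinct₃ edge₃-inj
        }

  degree≡2 : ∀ {v e f} → e ≢ f → IsEnd Γ v e → IsEnd Γ v f →
    (∀ g → g ≢ e → g ≢ f → ¬ IsEnd Γ v g) → degree Γ v ≡ 2
  degree≡2 {v} e≢f v-e v-f no-other =
    trans (cong sum (map-tabulate id incidence))
      (sum-tabulate-≡2 incidence e≢f (incidence-at v-e) (incidence-at v-f)
        (λ g g≢e g≢f → incidence-off (no-other g g≢e g≢f)))
    where
    incidence : Fin m → ℕ
    incidence g = if ⌊ isEnd? Γ v g ⌋ then 1 else 0

    incidence-at : ∀ {g} → IsEnd Γ v g → incidence g ≡ 1
    incidence-at {g} v-g =
      cong (λ b → if b then 1 else 0)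
        (trans (isYes≗does (isEnd? Γ v g)) (dec-true (isEnd? Γ v g) v-g))

    incidence-off : ∀ {g} → ¬ IsEnd Γ v g → incidence g ≡ 0
    incidence-off {g} ¬v-g =
      cong (λ b → if b then 1 else 0)
        (trans (isYes≗does (isEnd? Γ v g)) (dec-false (isEnd? Γ v g) ¬v-g))

  thirdEdge : ∀ {v e f} → degree Γ v ≢ 2 → e ≢ f → IsEnd Γ v e → IsEnd Γ v f →
    ∃ λ g → IsEnd Γ v g × g ≢ e × g ≢ f
  thirdEdge {v} {e} {f} deg≢2 e≢f v-e v-f
    with Finₚ.any? (λ g → isEnd? Γ v g ×-dec (¬? (g ≟ e) ×-dec ¬? (g ≟ f)))
  ... | yes (g , v-g , g≢e , g≢f) = g , v-g , g≢e , g≢f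
  ... | no none =
    contradiction (degree≡2 e≢f v-e v-f (λ g g≢e g≢f v-g → none (g , v-g , g≢e , g≢f))) deg≢2

  ≢-by-other-end : ∀ {e f v a b} → Joins Γ e v a → Joins Γ f v b → a ≢ b → e ≢ f
  ≢-by-other-end e-joins f-joins a≢b refl = a≢b (Joins-unique e-joins f-joins)

  neighbourOutside : KConnected 3 Γ → ∀ {v} (S : Subset n) → ∣ S ∣ < 3 → v ∉ S →
    ∃₂ λ f w → w ∉ S × Joins Γ f v w
  neighbourOutside (3<n , connected) {v} S ∣S∣<3 v∉S
    with ∃∉ (S ∪ ⁅ v ⁆) (ℕₚ.≤-<-trans (ℕₚ.≤-trans (∣p∪⁅x⁆∣≤1+∣p∣ S v) ∣S∣<3) 3<n)
  ... | z , z∉S∪v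
    with firstStep (connected S ∣S∣<3 v z v∉S (z∉S∪v ∘ x∈p∪q⁺ ∘ inj₁))
                   (x∉⁅y⁆⇒x≢y (z∉S∪v ∘ x∈p∪q⁺ ∘ inj₂) ∘ sym)
  ... | f , w , _ , w∉S , f-joins = f , w , w∉S , f-joins

  circleAvoiding-3connected : KConnected 3 Γ → ∀ {e v u} → Joins Γ e v u →
    ∃₂ λ f g → CircleThrough v f g × e ≢ f × e ≢ g
  circleAvoiding-3connected κ@(_ , connected) {e} {v} {u} e-joins
    with neighbourOutside κ ⁅ u ⁆ (ℕₚ.m≤n⇒m≤1+n (∣⁅x⁆∣<2 u)) (x≢y⇒x∉⁅y⁆ (Joins⇒≢ e-joins))
  ... | f , w , w∉u , f-joins
    with neighbourOutside κ (⁅ u ⁆ ∪ ⁅ w ⁆) (∣⁅x⁆∪⁅y⁆∣<3 u w)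
           ([ x≢y⇒x∉⁅y⁆ (Joins⇒≢ e-joins) , x≢y⇒x∉⁅y⁆ (Joins⇒≢ f-joins) ]′ ∘ x∈p∪q⁻ _ _)
  ... | g , w′ , w′∉uw , g-joins
    with toSimple (connected ⁅ v ⁆ (ℕₚ.m≤n⇒m≤1+n (∣⁅x⁆∣<2 v)) w w′
                    (x≢y⇒x∉⁅y⁆ (Joins⇒≢ f-joins ∘ sym)) (x≢y⇒x∉⁅y⁆ (Joins⇒≢ g-joins ∘ sym)))
  ... | path , simple =
    f , g , circle ,
    ≢-by-other-end e-joins f-joins (x∉⁅y⁆⇒x≢y w∉u ∘ sym) ,
    ≢-by-other-end e-joins g-joins (x∉⁅y⁆⇒x≢y (w′∉uw ∘ x∈p∪q⁺ ∘ inj₁) ∘ sym)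
    where
    circle : CircleThrough v f g
    circle = record
      { a = w
      ; b = w′
      ; f≢g = ≢-by-other-end f-joins g-joins (x∉⁅y⁆⇒x≢y (w′∉uw ∘ x∈p∪q⁺ ∘ inj₂) ∘ sym)
      ; f-joins = f-joins
      ; g-joins = Joins-sym g-joins
      ; path = unrestrict path
      ; path-simple = unrestrict-simple path simple
      ; v∉path =
          [ Joins⇒≢ f-joins , (λ v∉v → v∉v (x∈⁅x⁆ v)) ]′ ∘ InV⇒start⊎P path ∘ InV-unrestrict path
      }

  nonBridge⇒circle : ∀ {f v w} → ConnectedMinusEdges Γ ⁅ f ⁆ → Joins Γ f v w →
    ∃ λ h → CircleThrough v h f
  nonBridge⇒circle {f} {v} {w} connected f-joins with toSimple (connected v w)
  ... | here , _ = contradiction refl (Joins⇒≢ f-joins)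
  ... | step h h∉f _ h-joins path , v∉path , simple = h , record
    { a = _
    ; b = w
    ; f≢g = x∉⁅y⁆⇒x≢y h∉f
    ; f-joins = h-joins
    ; g-joins = Joins-sym f-joins
    ; path = unrestrict path
    ; path-simple = unrestrict-simple path simple
    ; v∉path = v∉path ∘ InV-unrestrict path
    }

  allPositive⇒lineConsistent : ∀ {σ} → (∀ e → σ e ≡ +) → LineConsistent Γ σ
  allPositive⇒lineConsistent {σ} σ≡+ D =
    product-map-positive (σ ∘ edge D) (allFin (suc (suc (k D)))) (λ i → σ≡+ (edge D i))

  lineConsistent⇒allPositive-3connected : KConnected 3 Γ → ∀ {σ} → LineConsistent Γ σ →
    ∀ e → σ e ≡ +
  lineConsistent⇒allPositive-3connected κ {σ} consistent e =
    let _ , _ , C , e≢f , e≢g = circleAvoiding-3connected κ (edge-joins e)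
    in positive-off-circle {σ} consistent {e = e} C (inj₁ refl) e≢f e≢g

  lineConsistent⇒allPositive-bridgeless : EdgeKConnected 2 Γ → (∀ v → degree Γ v ≢ 2) →
    ∀ {σ} → LineConsistent Γ σ → ∀ e → σ e ≡ +
  lineConsistent⇒allPositive-bridgeless κ no-deg2 {σ} consistent e
    with nonBridge⇒circle (κ ⁅ e ⁆ (∣⁅x⁆∣<2 e)) (edge-joins e)
  ... | f , C₁
    with thirdEdge (no-deg2 _) (f≢g C₁) (Joins⇒IsEnd₁ (f-joins C₁)) (inj₁ refl)
  ... | g , v-g , g≢f , g≢e
    with nonBridge⇒circle (κ ⁅ g ⁆ (∣⁅x⁆∣<2 g)) (proj₂ (IsEnd⇒Joins v-g))
  ... | h , C₂ with h ≟ e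
  ... | no h≢e =
    positive-off-circle {σ} consistent {e = e} C₂ (inj₁ refl) (h≢e ∘ sym) (g≢e ∘ sym)
  ... | yes refl =
    positive-triangle {σ} consistent {e = e} (inj₁ refl) v-f v-g
      (f≢e ∘ sym) (g≢e ∘ sym) (g≢f ∘ sym) σf≡+ σg≡+
    where
    v-f : IsEnd Γ (end₁ Γ e) f
    v-f = Joins⇒IsEnd₁ (f-joins C₁)
    f≢e : f ≢ e
    f≢e = f≢g C₁
    σg≡+ : σ g ≡ +
    σg≡+ = positive-off-circle {σ} consistent C₁ v-g g≢f g≢e
    σf≡+ : σ f ≡ +
    σf≡+ = positive-off-circle {σ} consistent C₂ v-f f≢e (g≢f ∘ sym)

-- The order bound is implied by 3-connectivity and not needed in the other case.
corollary4 : ∀ {n m} (Γ : Graph n m) (σ : Fin m → Sign) → 4 ≤ n →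
    (KConnected 3 Γ ⊎ (EdgeKConnected 2 Γ × (∀ v → degree Γ v ≢ 2))) →
    (LineConsistent Γ σ ⇔ (∀ e → σ e ≡ +))
corollary4 Γ σ _ (inj₁ κ) =
  mk⇔ (lineConsistent⇒allPositive-3connected Γ κ) (allPositive⇒lineConsistent Γ)
corollary4 Γ σ _ (inj₂ (κ , no-deg2)) =
  mk⇔ (lineConsistent⇒allPositive-bridgeless Γ κ no-deg2) (allPositive⇒lineConsistent Γ)
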